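{- In any nested SQS$(v)$, the number of ND-pairs with multiplicity $\frac{v-2}{2}$ is at most $\frac{v}{2}$.
   Context: A Steiner quadruple system SQS$(v)$ is a pair $(Q,\mathcal{B})$ where $Q$ is a set of $v$ points and $\mathcal{B}$ is a collection of 4-subsets of $Q$ (blocks) such that every 3-subset of $Q$ is contained in exactly one block. A nested SQS$(v)$ is an SQS$(v)$ together with a partition of each block into two 2-subsets (pairs). A pair of points is an ND-pair if it is one of the two pairs in the partition of at least one block; the multiplicity of a pair is the number of blocks whose partition contains that pair. -}

module Defs where

open import Data.Nat using (ℕ; _<_; _≤_; _/_; _∸_)
import Data.Nat as ℕ
open import Data.Fin using (Fin; toℕ; _≟_)
open import Data.List using (List; length; filter; cartesianProduct)
open import Data.List.Base using (allFin)
open import Data.Product using (Σ; _×_; _,_; proj₁; proj₂)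
open import Data.Sum using (_⊎_)
open import Relation.Nullary using (¬_; Dec)
open import Relation.Nullary.Decidable using (_×-dec_; _⊎-dec_)
open import Relation.Binary.PropositionalEquality using (_≡_)

-- A nested block on the point set Fin v: four pairwise distinct points
-- a b c d, partitioned into the two pairs {a,b} and {c,d}.
record NBlock (v : ℕ) : Set where
  field
    a b c d : Fin v
    a≢b : ¬ a ≡ b
    a≢c : ¬ a ≡ c
    a≢d : ¬ a ≡ d
    b≢c : ¬ b ≡ c
    b≢d : ¬ b ≡ d
    c≢d : ¬ c ≡ d
open NBlock public

_∈B_ : ∀ {v} → Fin v → NBlock v → Set
x ∈B B = x ≡ a B ⊎ x ≡ b B ⊎ x ≡ c B ⊎ x ≡ d B

record NestedSQS (v : ℕ) : Set where
  field
    m : ℕ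
    block : Fin m → NBlock v
    unique3 : (x y z : Fin v) → ¬ x ≡ y → ¬ x ≡ z → ¬ y ≡ z →
      Σ (Fin m) (λ i → (x ∈B block i) × (y ∈B block i) × (z ∈B block i)
        × ((j : Fin m) → (x ∈B block j) × (y ∈B block j) × (z ∈B block j) → j ≡ i))
open NestedSQS public

PairEq : ∀ {v} → Fin v → Fin v → Fin v → Fin v → Set
PairEq x y p q = (x ≡ p × y ≡ q) ⊎ (x ≡ q × y ≡ p)

pairEq? : ∀ {v} (x y p q : Fin v) → Dec (PairEq x y p q)
pairEq? x y p q = ((x ≟ p) ×-dec (y ≟ q)) ⊎-dec ((x ≟ q) ×-dec (y ≟ p))

InPartition : ∀ {v} → Fin v → Fin v → NBlock v → Set
InPartition x y B = PairEq x y (a B) (b B) ⊎ PairEq x y (c B) (d B)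

inPartition? : ∀ {v} (x y : Fin v) (B : NBlock v) → Dec (InPartition x y B)
inPartition? x y B = pairEq? x y (a B) (b B) ⊎-dec pairEq? x y (c B) (d B)

multiplicity : ∀ {v} → NestedSQS v → Fin v → Fin v → ℕ
multiplicity S x y = length (filter (λ i → inPartition? x y (block S i)) (allFin (m S)))

-- {x,y} (x ≠ y, represented by toℕ x < toℕ y) is an ND-pair of multiplicity k
NDPairMult : ∀ {v} → NestedSQS v → ℕ → Fin v × Fin v → Set
NDPairMult S k (x , y) = (toℕ x < toℕ y) × (1 ≤ multiplicity S x y) × (multiplicity S x y ≡ k)

ndPairMult? : ∀ {v} (S : NestedSQS v) (k : ℕ) (p : Fin v × Fin v) → Dec (NDPairMult S k p)
ndPairMult? S k (x , y) = (toℕ x ℕ.<? toℕ y) ×-dec ((1 ℕ.≤? multiplicity S x y) ×-dec (multiplicity S x y ℕ.≟ k))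

numNDPairsMult : ∀ {v} → NestedSQS v → ℕ → ℕ
numNDPairsMult {v} S k = length (filter (ndPairMult? S k) (cartesianProduct (allFin v) (allFin v)))

-- Let {x,y} have multiplicity μ and lie in a block t of which it is not one of the two
-- pairs. The complementary pairs of the μ blocks nesting {x,y}, together with the four
-- points of t, are 2μ + 4 distinct points, since every 3-set {x,y,p} lies in only one
-- block; so 2μ + 4 ≤ v. Hence a pair of multiplicity (v − 2)/2 is one of the two pairs
-- of every block containing it. Two such pairs {p,q} and {p,r} with q ≠ r would then
-- both be pairs of the block through {p,q,r}, which is impossible; so these pairs form
-- a matching and there are at most v/2 of them.
module Submission where

open import Defs
open import Data.Nat using (ℕ; _≤_; _<_; _+_; _*_; _/_; _∸_; _%_)
open import Data.Nat.Properties
  using (*-comm; *-suc; *-zeroʳ; +-monoʳ-<; +-monoˡ-<; m≤n+m∸n; <⇒≱; module ≤-Reasoning)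
open import Data.Nat.DivMod using (m≡m%n+[m/n]*n; m%n<n; m*n/n≡m; /-monoˡ-≤)
open import Data.Fin using (Fin; toℕ; _≟_; zero; suc)
open import Data.Fin.Properties using (injective⇒≤; <⇒≢; <-asym)
open import Data.List using (List; []; _∷_; _++_; length; lookup; filter; concatMap; cartesianProduct)
open import Data.List.Base using (allFin)
open import Data.List.Properties using (length-++; filter-≐)
open import Data.List.Membership.Propositional using (_∈_)
open import Data.List.Membership.Propositional.Properties using (∈-lookup; ∈-concatMap⁻)
open import Data.List.Relation.Unary.Any using (here; there)
open import Data.List.Relation.Unary.All as All using (All; []; _∷_)
open import Data.List.Relation.Unary.All.Properties as Allₚ using (all-filter)
open import Data.List.Relation.Unary.AllPairs using (AllPairs; []; _∷_)
import Data.List.Relation.Unary.AllPairs.Properties as AllPairs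
open import Data.List.Relation.Unary.Unique.Propositional using (Unique)
open import Data.List.Relation.Unary.Unique.Propositional.Properties
  using (++⁺; concat⁺; filter⁺; allFin⁺; cartesianProduct⁺)
open import Data.List.Relation.Binary.Disjoint.Propositional using (Disjoint)
open import Data.Product using (_×_; _,_; proj₁)
open import Data.Sum using (inj₁; inj₂)
open import Data.Empty using (⊥-elim)
open import Function using (_∘_; _on_)
open import Relation.Nullary using (¬_; yes; no)
open import Relation.Nullary.Decidable using (decidable-stable)
open import Relation.Unary using (Decidable)
open import Relation.Binary.PropositionalEquality
  using (_≡_; _≢_; refl; sym; trans; cong; cong₂; subst; ≢-sym; module ≡-Reasoning)

lookup-injective : ∀ {A : Set} {xs : List A} → Unique xs → ∀ i j → lookup xs i ≡ lookup xs j → i ≡ j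
lookup-injective (_ ∷ _) zero zero _ = refl
lookup-injective (x∉xs ∷ _) zero (suc j) eq = ⊥-elim (All.lookup x∉xs (∈-lookup j) eq)
lookup-injective (x∉xs ∷ _) (suc i) zero eq = ⊥-elim (All.lookup x∉xs (∈-lookup i) (sym eq))
lookup-injective (_ ∷ xs!) (suc i) (suc j) eq = cong suc (lookup-injective xs! i j eq)

Unique⇒length≤ : ∀ {n} {xs : List (Fin n)} → Unique xs → length xs ≤ n
Unique⇒length≤ xs! = injective⇒≤ (λ {i} {j} → lookup-injective xs! i j)

module _ {A B : Set} (f : A → List B) where

  length-concatMap-const : ∀ {k} xs → (∀ x → length (f x) ≡ k) → length (concatMap f xs) ≡ k * length xs
  length-concatMap-const {k} [] _ = sym (*-zeroʳ k)
  length-concatMap-const {k} (x ∷ xs) |f|≡k = begin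
    length (f x ++ concatMap f xs)         ≡⟨ length-++ (f x) ⟩
    length (f x) + length (concatMap f xs) ≡⟨ cong₂ _+_ (|f|≡k x) (length-concatMap-const xs |f|≡k) ⟩
    k + k * length xs                      ≡⟨ sym (*-suc k (length xs)) ⟩
    k * length (x ∷ xs)                    ∎
    where open ≡-Reasoning

  Unique-concatMap⁺ : {P : A → Set} {xs : List A} →
    (∀ {x} → P x → Unique (f x)) →
    (∀ {x y} → P x → P y → x ≢ y → Disjoint (f x) (f y)) →
    All P xs → Unique xs → Unique (concatMap f xs)
  Unique-concatMap⁺ {P} f-unique f-disjoint Pxs xs! =
    concat⁺ (Allₚ.map⁺ (All.map f-unique Pxs)) (AllPairs.map⁺ (disjoint Pxs xs!))
    where
    disjoint : ∀ {xs} → All P xs → Unique xs → AllPairs (Disjoint on f) xs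
    disjoint [] [] = []
    disjoint {x ∷ _} (Px ∷ Pxs) (x∉xs ∷ xs!) =
      All.zipWith {R = Disjoint (f x) ∘ f} (λ (Py , x≢y) → f-disjoint Px Py x≢y) (Pxs , x∉xs)
        ∷ disjoint Pxs xs!

v<4+2*[v∸2]/2 : ∀ v → v < 4 + 2 * ((v ∸ 2) / 2)
v<4+2*[v∸2]/2 v = begin-strict
  v                       ≤⟨ m≤n+m∸n v 2 ⟩
  2 + w                   ≡⟨ cong (2 +_) (m≡m%n+[m/n]*n w 2) ⟩
  2 + (w % 2 + w / 2 * 2) <⟨ +-monoʳ-< 2 (+-monoˡ-< (w / 2 * 2) (m%n<n w 2)) ⟩
  4 + w / 2 * 2           ≡⟨ cong (4 +_) (*-comm (w / 2) 2) ⟩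
  4 + 2 * (w / 2)         ∎
  where
  open ≤-Reasoning
  w = v ∸ 2

2*m≤n⇒m≤n/2 : ∀ {m n} → 2 * m ≤ n → m ≤ n / 2
2*m≤n⇒m≤n/2 {m} {n} 2m≤n = begin
  m         ≡⟨ sym (m*n/n≡m m 2) ⟩
  m * 2 / 2 ≤⟨ /-monoˡ-≤ 2 (subst (_≤ n) (*-comm 2 m) 2m≤n) ⟩
  n / 2     ∎
  where open ≤-Reasoning

TripleIn : ∀ {v} → Fin v → Fin v → Fin v → NBlock v → Set
TripleIn x y z B = x ∈B B × y ∈B B × z ∈B B

module _ {v : ℕ} (B : NBlock v) where

  a∈B : a B ∈B B
  a∈B = inj₁ refl

  b∈B : b B ∈B B
  b∈B = inj₂ (inj₁ refl)

  c∈B : c B ∈B B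
  c∈B = inj₂ (inj₂ (inj₁ refl))

  d∈B : d B ∈B B
  d∈B = inj₂ (inj₂ (inj₂ refl))

  points : List (Fin v)
  points = a B ∷ b B ∷ c B ∷ d B ∷ []

  points-unique : Unique points
  points-unique = (a≢b B ∷ a≢c B ∷ a≢d B ∷ []) ∷ (b≢c B ∷ b≢d B ∷ []) ∷ (c≢d B ∷ []) ∷ [] ∷ []

  ∈points⇒∈B : ∀ {p} → p ∈ points → p ∈B B
  ∈points⇒∈B (here refl) = a∈B
  ∈points⇒∈B (there (here refl)) = b∈B
  ∈points⇒∈B (there (there (here refl))) = c∈B
  ∈points⇒∈B (there (there (there (here refl)))) = d∈B

  InPartition-sym : ∀ {x y} → InPartition x y B → InPartition y x B
  InPartition-sym (inj₁ (inj₁ (x≡a , y≡b))) = inj₁ (inj₂ (y≡b , x≡a))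
  InPartition-sym (inj₁ (inj₂ (x≡b , y≡a))) = inj₁ (inj₁ (y≡a , x≡b))
  InPartition-sym (inj₂ (inj₁ (x≡c , y≡d))) = inj₂ (inj₂ (y≡d , x≡c))
  InPartition-sym (inj₂ (inj₂ (x≡d , y≡c))) = inj₂ (inj₁ (y≡c , x≡d))

  InPartition-functional : ∀ {p q r} → InPartition p q B → InPartition p r B → q ≡ r
  InPartition-functional (inj₁ (inj₁ (refl , refl))) (inj₁ (inj₁ (_ , refl))) = refl
  InPartition-functional (inj₁ (inj₁ (refl , refl))) (inj₁ (inj₂ (a≡b , _))) = ⊥-elim (a≢b B a≡b)
  InPartition-functional (inj₁ (inj₁ (refl , refl))) (inj₂ (inj₁ (a≡c , _))) = ⊥-elim (a≢c B a≡c)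
  InPartition-functional (inj₁ (inj₁ (refl , refl))) (inj₂ (inj₂ (a≡d , _))) = ⊥-elim (a≢d B a≡d)
  InPartition-functional (inj₁ (inj₂ (refl , refl))) (inj₁ (inj₁ (b≡a , _))) = ⊥-elim (a≢b B (sym b≡a))
  InPartition-functional (inj₁ (inj₂ (refl , refl))) (inj₁ (inj₂ (_ , refl))) = refl
  InPartition-functional (inj₁ (inj₂ (refl , refl))) (inj₂ (inj₁ (b≡c , _))) = ⊥-elim (b≢c B b≡c)
  InPartition-functional (inj₁ (inj₂ (refl , refl))) (inj₂ (inj₂ (b≡d , _))) = ⊥-elim (b≢d B b≡d)
  InPartition-functional (inj₂ (inj₁ (refl , refl))) (inj₁ (inj₁ (c≡a , _))) = ⊥-elim (a≢c B (sym c≡a))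
  InPartition-functional (inj₂ (inj₁ (refl , refl))) (inj₁ (inj₂ (c≡b , _))) = ⊥-elim (b≢c B (sym c≡b))
  InPartition-functional (inj₂ (inj₁ (refl , refl))) (inj₂ (inj₁ (_ , refl))) = refl
  InPartition-functional (inj₂ (inj₁ (refl , refl))) (inj₂ (inj₂ (c≡d , _))) = ⊥-elim (c≢d B c≡d)
  InPartition-functional (inj₂ (inj₂ (refl , refl))) (inj₁ (inj₁ (d≡a , _))) = ⊥-elim (a≢d B (sym d≡a))
  InPartition-functional (inj₂ (inj₂ (refl , refl))) (inj₁ (inj₂ (d≡b , _))) = ⊥-elim (b≢d B (sym d≡b))
  InPartition-functional (inj₂ (inj₂ (refl , refl))) (inj₂ (inj₁ (d≡c , _))) = ⊥-elim (c≢d B (sym d≡c))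
  InPartition-functional (inj₂ (inj₂ (refl , refl))) (inj₂ (inj₂ (_ , refl))) = refl

  -- Only meaningful when {x,y} is one of the two pairs of B.
  coPair : Fin v → Fin v → List (Fin v)
  coPair x y with pairEq? x y (a B) (b B)
  ... | yes _ = c B ∷ d B ∷ []
  ... | no _  = a B ∷ b B ∷ []

  length-coPair : ∀ x y → length (coPair x y) ≡ 2
  length-coPair x y with pairEq? x y (a B) (b B)
  ... | yes _ = refl
  ... | no _  = refl

  coPair-unique : ∀ x y → Unique (coPair x y)
  coPair-unique x y with pairEq? x y (a B) (b B)
  ... | yes _ = (c≢d B ∷ []) ∷ [] ∷ []
  ... | no _  = (a≢b B ∷ []) ∷ [] ∷ []

  coPair-spec : ∀ {x y p} → InPartition x y B → p ∈ coPair x y → TripleIn x y p B × x ≢ p × y ≢ p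
  coPair-spec {x} {y} xy∈B p∈co with pairEq? x y (a B) (b B)
  coPair-spec _ (here refl)         | yes (inj₁ (refl , refl)) = (a∈B , b∈B , c∈B) , a≢c B , b≢c B
  coPair-spec _ (there (here refl)) | yes (inj₁ (refl , refl)) = (a∈B , b∈B , d∈B) , a≢d B , b≢d B
  coPair-spec _ (here refl)         | yes (inj₂ (refl , refl)) = (b∈B , a∈B , c∈B) , b≢c B , a≢c B
  coPair-spec _ (there (here refl)) | yes (inj₂ (refl , refl)) = (b∈B , a∈B , d∈B) , b≢d B , a≢d B
  coPair-spec (inj₁ xy≐ab) _        | no xy≭ab = ⊥-elim (xy≭ab xy≐ab)
  coPair-spec (inj₂ (inj₁ (refl , refl))) (here refl)         | no _ = (c∈B , d∈B , a∈B) , a≢c B ∘ sym , a≢d B ∘ sym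
  coPair-spec (inj₂ (inj₁ (refl , refl))) (there (here refl)) | no _ = (c∈B , d∈B , b∈B) , b≢c B ∘ sym , b≢d B ∘ sym
  coPair-spec (inj₂ (inj₂ (refl , refl))) (here refl)         | no _ = (d∈B , c∈B , a∈B) , a≢d B ∘ sym , a≢c B ∘ sym
  coPair-spec (inj₂ (inj₂ (refl , refl))) (there (here refl)) | no _ = (d∈B , c∈B , b∈B) , b≢d B ∘ sym , b≢c B ∘ sym

module _ {v : ℕ} (S : NestedSQS v) where

  triple-block-unique : ∀ {x y z i j} → x ≢ y → x ≢ z → y ≢ z →
    TripleIn x y z (block S i) → TripleIn x y z (block S j) → i ≡ j
  triple-block-unique x≢y x≢z y≢z xyz∈i xyz∈j with unique3 S _ _ _ x≢y x≢z y≢z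
  ... | _ , _ , _ , _ , unique = trans (unique _ xyz∈i) (sym (unique _ xyz∈j))

  multiplicity-sym : ∀ x y → multiplicity S x y ≡ multiplicity S y x
  multiplicity-sym x y = cong length
    (filter-≐ (λ i → inPartition? x y (block S i)) (λ i → inPartition? y x (block S i))
              ((λ {i} → InPartition-sym (block S i)) , (λ {i} → InPartition-sym (block S i)))
              (allFin (m S)))

  ¬InPartition⇒4+2*multiplicity≤v : ∀ {x y t} → x ≢ y → x ∈B block S t → y ∈B block S t →
    ¬ InPartition x y (block S t) → 4 + 2 * multiplicity S x y ≤ v
  ¬InPartition⇒4+2*multiplicity≤v {x} {y} {t} x≢y x∈t y∈t xy∉t = begin
    4 + 2 * length nesting
      ≡⟨ cong (4 +_) (length-concatMap-const co nesting (λ i → length-coPair (block S i) x y)) ⟨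
    length (points (block S t) ++ concatMap co nesting)
      ≤⟨ Unique⇒length≤ (++⁺ (points-unique (block S t)) co-unique t∉co) ⟩
    v ∎
    where
    open ≤-Reasoning
    nesting : List (Fin (m S))
    nesting = filter (λ i → inPartition? x y (block S i)) (allFin (m S))

    co : Fin (m S) → List (Fin v)
    co i = coPair (block S i) x y

    block-of : ∀ {i j p} → InPartition x y (block S i) → p ∈ co i → TripleIn x y p (block S j) → i ≡ j
    block-of {i} xy∈i p∈i xyp∈j with coPair-spec (block S i) xy∈i p∈i
    ... | xyp∈i , x≢p , y≢p = triple-block-unique x≢y x≢p y≢p xyp∈i xyp∈j

    co-unique : Unique (concatMap co nesting)
    co-unique = Unique-concatMap⁺ co (λ {i} _ → coPair-unique (block S i) x y)
      (λ xy∈i xy∈j i≢j (p∈i , p∈j) → i≢j (block-of xy∈i p∈i (proj₁ (coPair-spec _ xy∈j p∈j))))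
      (all-filter _ (allFin (m S))) (filter⁺ _ (allFin⁺ (m S)))

    t∉co : Disjoint (points (block S t)) (concatMap co nesting)
    t∉co (p∈t , p∈co) = All.lookupWith
      (λ xy∈i p∈i → xy∉t (subst (InPartition x y ∘ block S)
                                 (block-of xy∈i p∈i (x∈t , y∈t , ∈points⇒∈B (block S t) p∈t)) xy∈i))
      (all-filter _ (allFin (m S))) (∈-concatMap⁻ co p∈co)

  Full : Fin v → Fin v → Set
  Full x y = x ≢ y × multiplicity S x y ≡ (v ∸ 2) / 2

  Full-sym : ∀ {x y} → Full x y → Full y x
  Full-sym {x} {y} (x≢y , μ≡k) = ≢-sym x≢y , trans (multiplicity-sym y x) μ≡k

  Full⇒InPartition : ∀ {x y t} → Full x y → x ∈B block S t → y ∈B block S t → InPartition x y (block S t)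
  Full⇒InPartition {x} {y} {t} (x≢y , μ≡k) x∈t y∈t =
    decidable-stable (inPartition? x y (block S t)) λ xy∉t →
      <⇒≱ (v<4+2*[v∸2]/2 v)
          (subst (λ μ → 4 + 2 * μ ≤ v) μ≡k (¬InPartition⇒4+2*multiplicity≤v x≢y x∈t y∈t xy∉t))

  Full-functional : ∀ {p q r} → Full p q → Full p r → q ≡ r
  Full-functional {p} {q} {r} pq pr with q ≟ r
  ... | yes q≡r = q≡r
  ... | no q≢r with unique3 S p q r (proj₁ pq) (proj₁ pr) q≢r
  ...   | t , p∈t , q∈t , r∈t , _ =
    InPartition-functional (block S t) (Full⇒InPartition pq p∈t q∈t) (Full⇒InPartition pr p∈t r∈t)

module _ {v : ℕ} {R : Fin v → Fin v → Set}
         (R-sym : ∀ {x y} → R x y → R y x) (R-functional : ∀ {x y z} → R x y → R x z → y ≡ z) where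

  Edge : Fin v × Fin v → Set
  Edge (x , y) = toℕ x < toℕ y × R x y

  ends : Fin v × Fin v → List (Fin v)
  ends (x , y) = x ∷ y ∷ []

  edge-determined-by-end : ∀ {e e' p} → Edge e → Edge e' → p ∈ ends e → p ∈ ends e' → e ≡ e'
  edge-determined-by-end (_ , xy) (_ , xy') (here refl) (here refl)
    with R-functional xy xy'
  ... | refl = refl
  edge-determined-by-end (x<y , xy) (y<x , yx) (here refl) (there (here refl))
    with R-functional xy (R-sym yx)
  ... | refl = ⊥-elim (<-asym x<y y<x)
  edge-determined-by-end (x<y , xy) (y<x , yx) (there (here refl)) (here refl)
    with R-functional (R-sym xy) yx
  ... | refl = ⊥-elim (<-asym x<y y<x)
  edge-determined-by-end (_ , xy) (_ , x'y) (there (here refl)) (there (here refl))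
    with R-functional (R-sym xy) (R-sym x'y)
  ... | refl = refl
  edge-determined-by-end _ _ (there (there ())) _
  edge-determined-by-end _ _ (here _) (there (there ()))
  edge-determined-by-end _ _ (there (here _)) (there (there ()))

  matching-size : ∀ {P : Fin v × Fin v → Set} (P? : Decidable P) → (∀ {e} → P e → Edge e) →
    2 * length (filter P? (cartesianProduct (allFin v) (allFin v))) ≤ v
  matching-size P? P⇒Edge = begin
    2 * length edges              ≡⟨ length-concatMap-const ends edges (λ _ → refl) ⟨
    length (concatMap ends edges) ≤⟨ Unique⇒length≤ ends-unique ⟩
    v                             ∎
    where
    open ≤-Reasoning
    pairs : List (Fin v × Fin v)
    pairs = cartesianProduct (allFin v) (allFin v)

    edges : List (Fin v × Fin v)
    edges = filter P? pairs

    ends-unique : Unique (concatMap ends edges)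
    ends-unique = Unique-concatMap⁺ ends (λ Pe → (<⇒≢ (proj₁ (P⇒Edge Pe)) ∷ []) ∷ [] ∷ [])
      (λ Pe Pe' e≢e' (p∈e , p∈e') → e≢e' (edge-determined-by-end (P⇒Edge Pe) (P⇒Edge Pe') p∈e p∈e'))
      (all-filter P? pairs) (filter⁺ P? (cartesianProduct⁺ (allFin⁺ v) (allFin⁺ v)))

lemma2p2 : (v : ℕ) (S : NestedSQS v) → numNDPairsMult S ((v ∸ 2) / 2) ≤ v / 2
lemma2p2 v S = 2*m≤n⇒m≤n/2
  (matching-size (Full-sym S) (Full-functional S) (ndPairMult? S ((v ∸ 2) / 2))
                 (λ (x<y , _ , μ≡k) → x<y , <⇒≢ x<y , μ≡k))
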